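{- Let $I=\langle N,E,(v_i)_{i\in N},\mathcal{M}\rangle$ be a matroid constrained fair division instance with additive valuations. For each $i\in N$ let $c_i$ be a constant and let $v'_i:2^E\to\mathbb{R}_{\ge0}$ be the additive valuation with $v'_i(\{g\})=v_i(\{g\})-c_i$ for all $g\in E$; let $I'=\langle N,E,(v'_i)_{i\in N},\mathcal{M}\rangle$. Then: (i) if $0\le c_i\le\min_{g\in E}v_i(\{g\})$ for all $i\in N$ and $A$ is a feasible EF1 allocation for $I'$, then $A$ is also an EF1 allocation for $I$; (ii) if $A$ is a feasible MMS allocation for $I'$, then $A$ is also an MMS allocation for $I$.
   Context: A matroid constrained fair division instance consists of agents $N=\{1,\dots,n\}$, a finite set $E$ of goods, valuations $v_i:2^E\to\mathbb{R}_{\ge0}$, and a matroid $\mathcal{M}$ on $E$. A valuation is additive if $v(T)=\sum_{g\in T}v(\{g\})$. A feasible allocation is a partition $(A_1,\dots,A_n)$ of $E$ in which each $A_j$ is a basis of $\mathcal{M}$; $\mathcal{A}$ is the set of feasible allocations. EF1: for all $i,j$ with $A_j\ne\emptyset$ there is $g\in A_j$ with $v_i(A_i)\ge v_i(A_j\setminus\{g\})$. Maximin share: $\mu_v^n(E)=\max_{A\in\mathcal{A}}\min_{j\in N}v(A_j)$; $A$ is MMS if $v_i(A_i)\ge\mu_{v_i}^n(E)$ for all $i$ (for $I'$, computed with $v'_i$).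
   Formalization: The valuations $v_i$ (through their singleton values) and the constants $c_i$ take rational values rather than real ones. -}

module Defs where

open import Data.Nat using (ℕ; zero; suc; NonZero; _<_)
open import Data.Fin using (Fin; zero; suc; _≟_)
open import Data.Fin.Subset using (Subset; ⁅_⁆; _∈_; _∉_; _⊆_; _∪_; _─_; ∣_∣; Nonempty; inside; outside)
  renaming (⊥ to ∅)
open import Data.Bool using (Bool; true; false; if_then_else_)
open import Data.Vec using (lookup; tabulate)
open import Data.Rational using (ℚ; 0ℚ; _+_; _-_; _⊓_; _≤_)
open import Data.Product using (Σ; ∃; _×_; _,_)
open import Relation.Nullary using (¬_; does)
open import Relation.Binary.PropositionalEquality using (_≡_)

record Matroid (m : ℕ) : Set₁ where
  field
    Indep       : Subset m → Set
    indep-∅     : Indep ∅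
    hereditary  : ∀ {X Y} → Y ⊆ X → Indep X → Indep Y
    augment     : ∀ {X Y} → Indep X → Indep Y → ∣ X ∣ < ∣ Y ∣ →
                  ∃ λ y → y ∈ Y × y ∉ X × Indep (X ∪ ⁅ y ⁆)

open Matroid public

IsBasis : ∀ {m} → Matroid m → Subset m → Set
IsBasis M B = Indep M B × (∀ S → Indep M S → B ⊆ S → S ⊆ B)

sumFin : (m : ℕ) → (Fin m → ℚ) → ℚ
sumFin zero    f = 0ℚ
sumFin (suc m) f = f zero + sumFin m (λ g → f (suc g))

-- Additive valuation determined by its values on singletons w g = v({g}).
val : ∀ {m} → (Fin m → ℚ) → Subset m → ℚ
val {m} w T = sumFin m (λ g → if lookup T g then w g else 0ℚ)

-- Allocations of goods Fin m to agents Fin n: each good goes to exactly one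
-- agent, i.e. an ordered partition (A_1,...,A_n) of E (parts may be empty).
Allocation : ℕ → ℕ → Set
Allocation m n = Fin m → Fin n

bundle : ∀ {m n} → Allocation m n → Fin n → Subset m
bundle A j = tabulate (λ g → if does (A g ≟ j) then inside else outside)

Feasible : ∀ {m n} → Matroid m → Allocation m n → Set
Feasible M A = ∀ j → IsBasis M (bundle A j)

EF1 : ∀ {m n} → (Fin n → Fin m → ℚ) → Allocation m n → Set
EF1 w A = ∀ i j → Nonempty (bundle A j) →
  ∃ λ g → g ∈ bundle A j × val (w i) (bundle A j ─ ⁅ g ⁆) ≤ val (w i) (bundle A i)

minFin : (n : ℕ) → .{{NonZero n}} → (Fin n → ℚ) → ℚ
minFin (suc zero)    f = f zero
minFin (suc (suc n)) f = f zero ⊓ minFin (suc n) (λ j → f (suc j))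

IsMMSValue : ∀ {m} (n : ℕ) → .{{NonZero n}} → Matroid m → (Fin m → ℚ) → ℚ → Set
IsMMSValue {m} n M w μ =
  (Σ (Allocation m n) λ B → Feasible M B × minFin n (λ j → val w (bundle B j)) ≡ μ)
  × (∀ (B : Allocation m n) → Feasible M B → minFin n (λ j → val w (bundle B j)) ≤ μ)

MMS : ∀ {m} (n : ℕ) → .{{NonZero n}} → Matroid m → (Fin n → Fin m → ℚ) → Allocation m n → Set
MMS n M w A = ∀ i μ → IsMMSValue n M (w i) μ → μ ≤ val (w i) (bundle A i)

shift : ∀ {m n} → (Fin n → Fin m → ℚ) → (Fin n → ℚ) → Fin n → Fin m → ℚ
shift w c i g = w i g - c i

{-# OPTIONS --safe #-}
module Submission where

-- Subtracting c from the value of every good lowers the value of a bundle T by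
-- c·|T|.  All bases of a matroid have the same size r, so on the bundles of a
-- feasible allocation the shift is the constant c·r: comparisons between whole
-- bundles, the minimum over bundles and hence the maximin share all move by
-- exactly c·r.  In an EF1 comparison the envied bundle has lost one good, so it
-- moves by c·(r - 1) only, which is where c ≥ 0 is needed.

open import Defs
open import Data.Nat as ℕ using (ℕ; NonZero; zero; suc)
import Data.Nat.Properties as ℕₚ
open import Data.Fin using (Fin; zero; suc)
open import Data.Fin.Subset using (Subset; ⁅_⁆; _∈_; _─_; ∣_∣; _∪_)
open import Data.Fin.Subset.Properties using (p⊆p∪q; x∈p∪q⁺; x∈⁅x⁆; p─⊥≡p)
open import Data.Vec using ([]; _∷_; here; there)
open import Data.Bool using (true; false)
open import Data.Rational using (ℚ; 0ℚ; _≤_; _+_; _-_; -_; _⊓_; +-0-rawMonoid)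
open import Data.Rational.Properties
  using (+-identityˡ; +-monoˡ-≤; +-monoʳ-≤; mono-≤-distrib-⊓; module ≤-Reasoning)
open import Data.Rational.Solver using (module +-*-Solver)
open import Algebra.Definitions.RawMonoid +-0-rawMonoid using () renaming (_×_ to _·_)
open import Data.Product using (_×_; _,_; proj₁)
open import Data.Sum using (inj₂)
open import Function using (_∘_)
open import Relation.Binary.PropositionalEquality using (_≡_; refl; sym; trans; cong; cong₂; subst; subst₂; module ≡-Reasoning)

open +-*-Solver

basis-maximum : ∀ {m} (M : Matroid m) {B X} → IsBasis M B → Indep M X → ∣ X ∣ ℕ.≤ ∣ B ∣
basis-maximum M {B} (indB , maximal) indX = ℕₚ.≮⇒≥ λ ∣B∣<∣X∣ →
  let y , _ , y∉B , indB∪y = augment M indB indX ∣B∣<∣X∣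
  in y∉B (maximal (B ∪ ⁅ y ⁆) indB∪y (p⊆p∪q ⁅ y ⁆) (x∈p∪q⁺ (inj₂ (x∈⁅x⁆ y))))

bases-equicardinal : ∀ {m} (M : Matroid m) {X Y} → IsBasis M X → IsBasis M Y → ∣ X ∣ ≡ ∣ Y ∣
bases-equicardinal M bX bY =
  ℕₚ.≤-antisym (basis-maximum M bY (proj₁ bX)) (basis-maximum M bX (proj₁ bY))

val-sub : ∀ {m} (w u : Fin m → ℚ) (T : Subset m) → val (λ g → w g - u g) T ≡ val w T - val u T
val-sub w u [] = refl
val-sub w u (true ∷ T) = trans (cong ((w zero - u zero) +_) (val-sub (w ∘ suc) (u ∘ suc) T))
  (solve 4 (λ a b x y → (a :- b) :+ (x :- y) := (a :+ x) :- (b :+ y)) refl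
    (w zero) (u zero) (val (w ∘ suc) T) (val (u ∘ suc) T))
val-sub w u (false ∷ T) = trans (cong (0ℚ +_) (val-sub (w ∘ suc) (u ∘ suc) T))
  (solve 2 (λ x y → con 0ℚ :+ (x :- y) := (con 0ℚ :+ x) :- (con 0ℚ :+ y)) refl
    (val (w ∘ suc) T) (val (u ∘ suc) T))

val-const : ∀ {m} (c : ℚ) (T : Subset m) → val (λ _ → c) T ≡ ∣ T ∣ · c
val-const c []          = refl
val-const c (true ∷ T)  = cong (c +_) (val-const c T)
val-const c (false ∷ T) = trans (+-identityˡ _) (val-const c T)

val-remove : ∀ {m} (w : Fin m → ℚ) {T : Subset m} {g} → g ∈ T → val w T ≡ val w (T ─ ⁅ g ⁆) + w g
val-remove w {true ∷ T} here =
  trans (cong (λ S → w zero + val (w ∘ suc) S) (sym (p─⊥≡p T)))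
    (solve 2 (λ a x → a :+ x := (con 0ℚ :+ x) :+ a) refl (w zero) (val (w ∘ suc) (T ─ _)))
val-remove w {true ∷ T} {suc g} (there g∈T) =
  trans (cong (w zero +_) (val-remove (w ∘ suc) g∈T))
    (solve 3 (λ a x b → a :+ (x :+ b) := (a :+ x) :+ b) refl
      (w zero) (val (w ∘ suc) (T ─ ⁅ g ⁆)) (w (suc g)))
val-remove w {false ∷ T} {suc g} (there g∈T) =
  trans (cong (0ℚ +_) (val-remove (w ∘ suc) g∈T))
    (solve 2 (λ x b → con 0ℚ :+ (x :+ b) := (con 0ℚ :+ x) :+ b) refl
      (val (w ∘ suc) (T ─ ⁅ g ⁆)) (w (suc g)))

val-const-bases : ∀ {m} (M : Matroid m) (c : ℚ) {X Y} → IsBasis M X → IsBasis M Y →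
  val (λ _ → c) X ≡ val (λ _ → c) Y
val-const-bases M c {X} {Y} bX bY = begin
  val (λ _ → c) X  ≡⟨ val-const c X ⟩
  ∣ X ∣ · c        ≡⟨ cong (_· c) (bases-equicardinal M bX bY) ⟩
  ∣ Y ∣ · c        ≡⟨ val-const c Y ⟨
  val (λ _ → c) Y  ∎
  where open ≡-Reasoning

minFin-sub : ∀ n .{{_ : NonZero n}} (f g : Fin n → ℚ) (k : ℚ) → (∀ j → g j ≡ f j - k) →
  minFin n g ≡ minFin n f - k
minFin-sub (suc zero)    f g k g≡f-k = g≡f-k zero
minFin-sub (suc (suc n)) f g k g≡f-k =
  trans (cong₂ _⊓_ (g≡f-k zero) (minFin-sub (suc n) (f ∘ suc) (g ∘ suc) k (g≡f-k ∘ suc)))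
    (sym (mono-≤-distrib-⊓ (+-monoˡ-≤ (- k)) (f zero) (minFin (suc n) (f ∘ suc))))

sub-cancelʳ-≤ : ∀ k {a b} → a - k ≤ b - k → a ≤ b
sub-cancelʳ-≤ k {a} {b} a-k≤b-k = begin
  a            ≡⟨ solve 2 (λ a k → a := (a :- k) :+ k) refl a k ⟩
  (a - k) + k  ≤⟨ +-monoˡ-≤ k a-k≤b-k ⟩
  (b - k) + k  ≡⟨ solve 2 (λ b k → (b :- k) :+ k := b) refl b k ⟩
  b            ∎
  where open ≤-Reasoning

sub-cancelʳ-≤-nonNeg : ∀ k {a b c} → 0ℚ ≤ c → a - k ≤ b - (k + c) → a ≤ b
sub-cancelʳ-≤-nonNeg k {a} {b} {c} 0≤c a-k≤b-k-c = sub-cancelʳ-≤ k (begin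
  a - k              ≡⟨ solve 2 (λ a k → a :- k := (a :- k) :+ con 0ℚ) refl a k ⟩
  (a - k) + 0ℚ       ≤⟨ +-monoʳ-≤ (a - k) 0≤c ⟩
  (a - k) + c        ≤⟨ +-monoˡ-≤ c a-k≤b-k-c ⟩
  (b - (k + c)) + c  ≡⟨ solve 3 (λ b k c → (b :- (k :+ c)) :+ c := b :- k) refl b k c ⟩
  b - k              ∎)
  where open ≤-Reasoning

EF1-comparison-unshift : ∀ {m} (M : Matroid m) (w : Fin m → ℚ) {c : ℚ} → 0ℚ ≤ c →
  ∀ {X Y g} → IsBasis M X → IsBasis M Y → g ∈ Y →
  val (λ h → w h - c) (Y ─ ⁅ g ⁆) ≤ val (λ h → w h - c) X → val w (Y ─ ⁅ g ⁆) ≤ val w X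
EF1-comparison-unshift M w {c} 0≤c {X} {Y} {g} bX bY g∈Y shifted =
  sub-cancelʳ-≤-nonNeg (cost (Y ─ ⁅ g ⁆)) 0≤c
    (subst₂ _≤_ (val-sub w (λ _ → c) (Y ─ ⁅ g ⁆))
      (trans (val-sub w (λ _ → c) X) (cong (λ k → val w X - k) cost[X]≡cost[Y-g]+c)) shifted)
  where
  cost : Subset _ → ℚ
  cost = val (λ _ → c)
  cost[X]≡cost[Y-g]+c : cost X ≡ cost (Y ─ ⁅ g ⁆) + c
  cost[X]≡cost[Y-g]+c = trans (val-const-bases M c bX bY) (val-remove (λ _ → c) g∈Y)

EF1-unshift : ∀ {m n} (M : Matroid m) (w : Fin n → Fin m → ℚ) (c : Fin n → ℚ) →
  (∀ i → 0ℚ ≤ c i) → (A : Allocation m n) → Feasible M A → EF1 (shift w c) A → EF1 w A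
EF1-unshift M w c 0≤c A feasible ef1 i j nonempty =
  let g , g∈Aj , shifted = ef1 i j nonempty
  in g , g∈Aj , EF1-comparison-unshift M (w i) (0≤c i) (feasible i) (feasible j) g∈Aj shifted

minVal-sub-const : ∀ {m} n .{{_ : NonZero n}} (M : Matroid m) (w : Fin m → ℚ) (c : ℚ) {B₀} →
  IsBasis M B₀ → ∀ B → Feasible M B →
  minFin n (λ j → val (λ g → w g - c) (bundle B j)) ≡ minFin n (λ j → val w (bundle B j)) - val (λ _ → c) B₀
minVal-sub-const n M w c b₀ B feasible = minFin-sub n _ _ _ λ j →
  trans (val-sub w (λ _ → c) (bundle B j)) (cong (λ k → val w (bundle B j) - k) (val-const-bases M c (feasible j) b₀))

IsMMSValue-sub-const : ∀ {m} n .{{_ : NonZero n}} (M : Matroid m) (w : Fin m → ℚ) (c : ℚ) {B₀} →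
  IsBasis M B₀ → ∀ {μ} → IsMMSValue n M w μ → IsMMSValue n M (λ g → w g - c) (μ - val (λ _ → c) B₀)
IsMMSValue-sub-const n M w c {B₀} b₀ {μ} ((B , feasible , min≡μ) , maximal) =
  (B , feasible , trans (minVal-sub-const n M w c b₀ B feasible) (cong (_- k) min≡μ)) ,
  λ B′ feasible′ → subst (_≤ μ - k) (sym (minVal-sub-const n M w c b₀ B′ feasible′))
    (+-monoˡ-≤ (- k) (maximal B′ feasible′))
  where
  k : ℚ
  k = val (λ _ → c) B₀

MMS-unshift : ∀ {m} n .{{_ : NonZero n}} (M : Matroid m) (w : Fin n → Fin m → ℚ) (c : Fin n → ℚ) →
  (A : Allocation m n) → Feasible M A → MMS n M (shift w c) A → MMS n M w A
MMS-unshift n M w c A feasible mms i μ μ-isMMS = sub-cancelʳ-≤ k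
  (subst (μ - k ≤_) (val-sub (w i) (λ _ → c i) (bundle A i))
    (mms i (μ - k) (IsMMSValue-sub-const n M (w i) (c i) (feasible i) μ-isMMS)))
  where
  k : ℚ
  k = val (λ _ → c i) (bundle A i)

lemma5p1 : (m n : ℕ) → .{{_ : NonZero n}} → (M : Matroid m)
    → (w : Fin n → Fin m → ℚ) → (∀ i g → 0ℚ ≤ w i g)
    → (c : Fin n → ℚ)
    → ((∀ i → 0ℚ ≤ c i) → (∀ i g → c i ≤ w i g)
         → (A : Allocation m n) → Feasible M A → EF1 (shift w c) A → EF1 w A)
      × ((∀ i g → c i ≤ w i g)
         → (A : Allocation m n) → Feasible M A → MMS n M (shift w c) A → MMS n M w A)
lemma5p1 m n M w _ c = (λ 0≤c _ → EF1-unshift M w c 0≤c) , (λ _ → MMS-unshift n M w c)
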